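{- Let $k\geq 2$ and let $\mathbf{u}$ be a $k$-automatic sequence over a finite alphabet $\mathcal{A}$ which is not eventually periodic. Let $U\in\mathcal{A}^*$, $V\in\mathcal{A}^+$ and $s\in\mathbb{Q}$, $s>0$, be such that $UV^s$ is a prefix of $\mathbf{u}$. Let $m$ be the cardinality of the $k$-kernel of $\mathbf{u}$. Then $\frac{|UV^s|}{|UV|}<k^m$.
   Context: $\mathcal{A}^*$ is the set of finite words over $\mathcal{A}$ and $\mathcal{A}^+$ the set of non-empty finite words; $|W|$ is the length of $W$. For a positive real $x$ and finite word $W$, $W^x$ denotes $W^{\lfloor x\rfloor}W'$ where $W'$ is the prefix of $W$ of length $\lceil (x-\lfloor x\rfloor)|W|\rceil$. The $k$-kernel of $\mathbf{u}=(u_n)_{n\geq0}$ is the set of sequences $(u_{k^e n+j})_{n\geq0}$ with $e\geq 0$, $0\leq j<k^e$; a sequence is $k$-automatic iff its $k$-kernel is finite. -}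

module Defs where

open import Data.Nat as ℕ using (ℕ; _+_; _*_; _^_; _<_; _≥_)
open import Data.Integer as ℤ using (ℤ)
open import Data.Rational as ℚ using (ℚ; floor; ceiling; _/_)
open import Data.Fin using (Fin; toℕ)
open import Data.List using (List; _++_; length; replicate; concat; take; lookup)
open import Data.Product using (Σ; ∃; _×_; _,_)
open import Relation.Binary.PropositionalEquality using (_≡_)
open import Relation.Nullary using (¬_)

Seq : Set → Set
Seq A = ℕ → A

EventuallyPeriodic : {A : Set} → Seq A → Set
EventuallyPeriodic u =
  Σ ℕ λ p → Σ ℕ λ N → (0 < p) × (∀ n → n ≥ N → u (n + p) ≡ u n)

KernelIndex : ℕ → Set
KernelIndex k = Σ ℕ λ e → Σ ℕ λ j → j < k ^ e

kernelSeq : {A : Set} → Seq A → (k : ℕ) → KernelIndex k → Seq A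
kernelSeq u k (e , j , _) n = u (k ^ e * n + j)

-- The k-kernel of u (a set of sequences, equality of sequences being
-- extensional) has exactly m elements: there are m pairwise distinct kernel
-- elements and every kernel element equals one of them.
KernelCard : {A : Set} → Seq A → ℕ → ℕ → Set
KernelCard u k m =
  Σ (Fin m → KernelIndex k) λ r →
    (∀ i i' → (∀ n → kernelSeq u k (r i) n ≡ kernelSeq u k (r i') n) → i ≡ i')
    × (∀ t → ∃ λ i → ∀ n → kernelSeq u k t n ≡ kernelSeq u k (r i) n)

ℕ→ℚ : ℕ → ℚ
ℕ→ℚ n = ℤ.+ n / 1

-- W^x = W^{⌊x⌋} W' with W' the prefix of W of length ⌈(x - ⌊x⌋)|W|⌉.
-- (for x > 0, ⌊x⌋ ≥ 0, so ∣⌊x⌋∣ is ⌊x⌋ as a natural number)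
wpow : {A : Set} → List A → ℚ → List A
wpow W x =
  concat (replicate ℤ.∣ floor x ∣ W)
  ++ take ℤ.∣ ceiling ((x ℚ.- (floor x / 1)) ℚ.* ℕ→ℚ (length W)) ∣ W

IsPrefix : {A : Set} → List A → Seq A → Set
IsPrefix W u = ∀ (i : Fin (length W)) → lookup W i ≡ u (toℕ i)

-- Write a = |U|, p = |V| and suppose |UV^s| ≥ k^m (a + p), so that u has
-- period p on the window [a, k^m (a + p)). Say a sequence is periodic to
-- level j if it has period p on [a, k^j (a + p)). If f is periodic to level
-- j + 1, each decimation n ↦ f (k n + r) is periodic to level j; conversely, if
-- f and all its decimations are periodic to level j + 1, then f has period k p
-- on [k a, k^(j+2) (a + p)), and this long period propagates the period p of f
-- up to level j + 2. Hence a kernel element that is periodic exactly to level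
-- j + 1 has a decimation, again a kernel element, periodic exactly to level j.
-- An element periodic exactly to some level ≥ m would thus yield kernel
-- elements periodic exactly to m + 1 distinct levels, although there are only m
-- of them. So u is periodic to every level, i.e. eventually periodic.

{-# OPTIONS --safe #-}
module Submission where

open import Defs
open import Data.Nat using (ℕ; _+_; _*_; _^_; _<_; _≥_)
open import Data.Fin using (Fin)
open import Data.List using (List; _++_; length)
open import Data.Rational using (ℚ; 0ℚ) renaming (_<_ to _<ℚ_)
open import Relation.Nullary using (¬_)

open import Data.Integer using (∣_∣)
open import Data.Rational using (floor)
open import Data.Nat using (zero; suc; pred; _≤_; _∸_; z≤n; z<s; _≤?_; _<?_; NonZero; >-nonZero)
open import Data.Nat.Properties
open import Data.Nat.DivMod using (_mod_; _divMod_; result; [m+n]%n≡m%n; m<n⇒m%n≡m)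
open import Data.Nat.Tactic.RingSolver using (solve-∀)
open import Data.Fin using (zero; suc; toℕ; fromℕ<) renaming (_≟_ to _≟ᶠ_)
open import Data.Fin.Properties using (toℕ<n; toℕ-fromℕ<; fromℕ<-toℕ; fromℕ<-cong; pigeonhole; ¬∀⟶∃¬)
open import Data.List using ([]; _∷_; concat; replicate; take; lookup)
open import Data.List.Properties using (length-++; ++-assoc)
open import Data.Product using (∃; _×_; _,_; proj₁; proj₂)
open import Function using (_∘_)
open import Relation.Binary.Definitions using (DecidableEquality)
open import Relation.Binary.PropositionalEquality
  using (_≡_; _≗_; refl; sym; trans; cong; subst; module ≡-Reasoning)
open import Relation.Nullary using (Dec; yes; no)
open import Relation.Nullary.Decidable using (map′; _→-dec_; decidable-stable)

n<k^n : ∀ {k} .{{_ : NonZero k}} → 1 < k → ∀ n → n < k ^ n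
n<k^n         1<k zero    = z<s
n<k^n {k} 1<k (suc n) = begin-strict
  suc n      ≤⟨ n<k^n 1<k n ⟩
  k ^ n      <⟨ m<m*n (k ^ n) k {{m^n≢0 k n}} 1<k ⟩
  k ^ n * k  ≡⟨ *-comm (k ^ n) k ⟩
  k ^ suc n  ∎
  where open ≤-Reasoning

k*q+r<k*[1+q] : ∀ k q {r} → r < k → k * q + r < k * suc q
k*q+r<k*[1+q] k q {r} r<k = begin-strict
  k * q + r  <⟨ +-monoʳ-< (k * q) r<k ⟩
  k * q + k  ≡⟨ +-comm (k * q) k ⟩
  k + k * q  ≡⟨ *-suc k q ⟨
  k * suc q  ∎
  where open ≤-Reasoning

k[n+p]+r≡kn+r+kp : ∀ k n p r → k * (n + p) + r ≡ k * n + r + k * p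
k[n+p]+r≡kn+r+kp = solve-∀

PeriodicOn : {A : Set} → ℕ → ℕ → ℕ → Seq A → Set
PeriodicOn a p B f = ∀ {n} → a ≤ n → n + p < B → f n ≡ f (n + p)

module _ {A : Set} where

  PeriodicOn-≗ : ∀ {a p B} {f g : Seq A} → f ≗ g → PeriodicOn a p B f → PeriodicOn a p B g
  PeriodicOn-≗ f≗g per a≤n lt = trans (sym (f≗g _)) (trans (per a≤n lt) (f≗g _))

  PeriodicOn-mono : ∀ {a a′ p B B′} {f : Seq A} →
                    a ≤ a′ → B′ ≤ B → PeriodicOn a p B f → PeriodicOn a′ p B′ f
  PeriodicOn-mono a≤a′ B′≤B per a′≤n lt = per (≤-trans a≤a′ a′≤n) (<-≤-trans lt B′≤B)

  PeriodicOn? : DecidableEquality A → ∀ a p B (f : Seq A) → Dec (PeriodicOn a p B f)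
  PeriodicOn? _≟ᴬ_ a p B f =
    map′ fromBounded (λ per _ → per)
      (allUpTo? (λ n → a ≤? n →-dec (n + p <? B →-dec f n ≟ᴬ f (n + p))) B)
    where
      fromBounded : (∀ {n} → n < B → a ≤ n → n + p < B → f n ≡ f (n + p)) → PeriodicOn a p B f
      fromBounded per {n} a≤n lt = per (≤-<-trans (m≤m+n n p) lt) a≤n lt

  PeriodicOn-* : ∀ {a p B} {f : Seq A} → PeriodicOn a p B f → ∀ t → PeriodicOn a (t * p) B f
  PeriodicOn-* {f = f} per zero {n} _ _ = cong f (sym (+-identityʳ n))
  PeriodicOn-* {a} {p} {B} {f} per (suc t) {n} a≤n lt = begin
      f n                ≡⟨ per a≤n (≤-<-trans (m≤m+n (n + p) (t * p)) lt′) ⟩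
      f (n + p)          ≡⟨ PeriodicOn-* per t (≤-trans a≤n (m≤m+n n p)) lt′ ⟩
      f (n + p + t * p)  ≡⟨ cong f (+-assoc n p (t * p)) ⟩
      f (n + (p + t * p)) ∎
    where
      open ≡-Reasoning
      lt′ : n + p + t * p < B
      lt′ = subst (_< B) (sym (+-assoc n p (t * p))) lt

  PeriodicOn-shift : ∀ {a p B} {f : Seq A} →
                     PeriodicOn 0 p B (λ n → f (a + n)) → PeriodicOn a p (a + B) f
  PeriodicOn-shift {a} {p} {B} {f} per a≤n lt with m≤n⇒∃[o]m+o≡n a≤n
  ... | d , refl = trans (per z≤n d+p<B) (cong f (sym (+-assoc a d p)))
    where
      d+p<B : d + p < B
      d+p<B = +-cancelˡ-< a (d + p) B (subst (_< a + B) (+-assoc a d p) lt)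

  PeriodicOn-decimate : ∀ {k a p B r} {f : Seq A} .{{_ : NonZero k}} → r < k →
                        PeriodicOn a (k * p) (k * B) f →
                        PeriodicOn a p B (λ n → f (k * n + r))
  PeriodicOn-decimate {k} {a} {p} {B} {r} {f} r<k per {n} a≤n lt =
    trans (per a≤kn+r kn+r+kp<kB) (cong f (sym (k[n+p]+r≡kn+r+kp k n p r)))
    where
      a≤kn+r : a ≤ k * n + r
      a≤kn+r = ≤-trans a≤n (≤-trans (m≤n*m n k) (m≤m+n (k * n) r))
      kn+r+kp<kB : k * n + r + k * p < k * B
      kn+r+kp<kB = begin-strict
        k * n + r + k * p  ≡⟨ k[n+p]+r≡kn+r+kp k n p r ⟨
        k * (n + p) + r    <⟨ k*q+r<k*[1+q] k (n + p) r<k ⟩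
        k * suc (n + p)    ≤⟨ *-monoʳ-≤ k lt ⟩
        k * B              ∎
        where open ≤-Reasoning

  PeriodicOn-interleave : ∀ {k a p B} {f : Seq A} .{{_ : NonZero k}} →
                          (∀ (r : Fin k) → PeriodicOn a p B (λ n → f (k * n + toℕ r))) →
                          PeriodicOn (k * a) (k * p) (k * B) f
  PeriodicOn-interleave {k} {a} {p} {B} {f} per {n} ka≤n lt with n divMod k
  ... | result q r n≡r+qk = let open ≡-Reasoning in begin
      f n                      ≡⟨ cong f n≡kq+r ⟩
      f (k * q + toℕ r)        ≡⟨ per r a≤q q+p<B ⟩
      f (k * (q + p) + toℕ r)  ≡⟨ cong f k[q+p]+r≡n+kp ⟩
      f (n + k * p)            ∎
    where
      n≡kq+r : n ≡ k * q + toℕ r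
      n≡kq+r = trans n≡r+qk (trans (+-comm (toℕ r) (q * k)) (cong (_+ toℕ r) (*-comm q k)))
      k[q+p]+r≡n+kp : k * (q + p) + toℕ r ≡ n + k * p
      k[q+p]+r≡n+kp = trans (k[n+p]+r≡kn+r+kp k q p (toℕ r)) (cong (_+ k * p) (sym n≡kq+r))
      a≤q : a ≤ q
      a≤q = ≤-pred (*-cancelˡ-< k a (suc q)
              (≤-<-trans ka≤n (subst (_< k * suc q) (sym n≡kq+r) (k*q+r<k*[1+q] k q (toℕ<n r)))))
      q+p<B : q + p < B
      q+p<B = *-cancelˡ-< k (q + p) B (begin-strict
        k * (q + p)            ≡⟨ *-distribˡ-+ k q p ⟩
        k * q + k * p          ≤⟨ +-monoˡ-≤ (k * p) (m≤m+n (k * q) (toℕ r)) ⟩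
        k * q + toℕ r + k * p  ≡⟨ cong (_+ k * p) n≡kq+r ⟨
        n + k * p              <⟨ lt ⟩
        k * B                  ∎)
        where open ≤-Reasoning

  -- A point n of [a, C) beyond B is reached from n′ = n + p − k p ≥ k a by the
  -- long period k p, and n′ is linked to n by k − 1 steps of p below n.
  PeriodicOn-extend : ∀ {k a p B} {f : Seq A} .{{_ : NonZero k}} → 0 < p → k * (a + p) ≤ B →
                      PeriodicOn a p B f →
                      ∀ C → PeriodicOn (k * a) (k * p) C f → PeriodicOn a p C f
  PeriodicOn-extend 0<p kL≤B per zero perᵏ a≤n ()
  PeriodicOn-extend {k} {a} {p} {B} {f} 0<p kL≤B per (suc C) perᵏ {n} a≤n n+p<1+C
    with n + p <? B
  ... | yes n+p<B = per a≤n n+p<B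
  ... | no n+p≮B = begin
      f n                  ≡⟨ cong f n′+[k-1]p≡n ⟨
      f (n′ + pred k * p)  ≡⟨ PeriodicOn-* below-C (pred k) a≤n′ n′+[k-1]p<C ⟨
      f n′                 ≡⟨ perᵏ ka≤n′ (subst (_< suc C) (sym n′+kp≡n+p) n+p<1+C) ⟩
      f (n′ + k * p)       ≡⟨ cong f n′+kp≡n+p ⟩
      f (n + p)            ∎
    where
      open ≡-Reasoning
      below-C : PeriodicOn a p C f
      below-C = PeriodicOn-extend 0<p kL≤B per C (PeriodicOn-mono ≤-refl (n≤1+n C) perᵏ)
      ka+kp≤n+p : k * a + k * p ≤ n + p
      ka+kp≤n+p = ≤-trans (≤-reflexive (sym (*-distribˡ-+ k a p))) (≤-trans kL≤B (≮⇒≥ n+p≮B))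
      n′ : ℕ
      n′ = n + p ∸ k * p
      n′+kp≡n+p : n′ + k * p ≡ n + p
      n′+kp≡n+p = m∸n+n≡m (≤-trans (m≤n+m (k * p) (k * a)) ka+kp≤n+p)
      ka≤n′ : k * a ≤ n′
      ka≤n′ = +-cancelʳ-≤ (k * p) (k * a) n′ (subst (k * a + k * p ≤_) (sym n′+kp≡n+p) ka+kp≤n+p)
      a≤n′ : a ≤ n′
      a≤n′ = ≤-trans (m≤n*m a k) ka≤n′
      n′+[k-1]p≡n : n′ + pred k * p ≡ n
      n′+[k-1]p≡n = +-cancelʳ-≡ p (n′ + pred k * p) n (begin
        n′ + pred k * p + p   ≡⟨ +-assoc n′ (pred k * p) p ⟩
        n′ + (pred k * p + p) ≡⟨ cong (n′ +_) (+-comm (pred k * p) p) ⟩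
        n′ + suc (pred k) * p ≡⟨ cong (λ k′ → n′ + k′ * p) (suc-pred k) ⟩
        n′ + k * p            ≡⟨ n′+kp≡n+p ⟩
        n + p                 ∎)
      n′+[k-1]p<C : n′ + pred k * p < C
      n′+[k-1]p<C = subst (_< C) (sym n′+[k-1]p≡n) (<-≤-trans (m<m+n n 0<p) (≤-pred n+p<1+C))

module Levels {A : Set} (_≟ᴬ_ : DecidableEquality A) (k : ℕ) .{{_ : NonZero k}}
              (a p : ℕ) (0<p : 0 < p) where

  PeriodicToLevel : ℕ → Seq A → Set
  PeriodicToLevel j = PeriodicOn a p (k ^ j * (a + p))

  PeriodicToLevel? : ∀ j f → Dec (PeriodicToLevel j f)
  PeriodicToLevel? j = PeriodicOn? _≟ᴬ_ a p (k ^ j * (a + p))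

  PeriodicToLevel-antitone : ∀ {i j f} → i ≤ j → PeriodicToLevel j f → PeriodicToLevel i f
  PeriodicToLevel-antitone i≤j = PeriodicOn-mono ≤-refl (*-monoˡ-≤ (a + p) (^-monoʳ-≤ k i≤j))

  level-suc : ∀ j → k ^ suc j * (a + p) ≡ k * (k ^ j * (a + p))
  level-suc j = *-assoc k (k ^ j) (a + p)

  PeriodicToLevel-decimate : ∀ {j r f} → r < k → PeriodicToLevel (suc j) f →
                             PeriodicToLevel j (λ n → f (k * n + r))
  PeriodicToLevel-decimate {j} {f = f} r<k per =
    PeriodicOn-decimate r<k (subst (λ B → PeriodicOn a (k * p) B f) (level-suc j) (PeriodicOn-* per k))

  PeriodicToLevel-interleave : ∀ {j f} → PeriodicToLevel (suc j) f →
                               (∀ (r : Fin k) → PeriodicToLevel (suc j) (λ n → f (k * n + toℕ r))) →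
                               PeriodicToLevel (suc (suc j)) f
  PeriodicToLevel-interleave {j} {f} per decimations =
    PeriodicOn-extend 0<p (*-monoˡ-≤ (a + p) k≤k^[1+j]) per _
      (subst (λ B → PeriodicOn (k * a) (k * p) B f) (sym (level-suc (suc j)))
        (PeriodicOn-interleave {f = f} decimations))
    where
      k≤k^[1+j] : k ≤ k ^ suc j
      k≤k^[1+j] = subst (_≤ k ^ suc j) (*-identityʳ k) (*-monoʳ-≤ k (m^n>0 k j))

  module _ {m : ℕ} (g : Fin m → Seq A)
           (decimation-closed : ∀ x (r : Fin k) → ∃ λ y → g y ≗ (λ n → g x (k * n + toℕ r))) where

    MaxLevel : ℕ → Fin m → Set
    MaxLevel j x = PeriodicToLevel j (g x) × ¬ PeriodicToLevel (suc j) (g x)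

    MaxLevel-unique : ∀ {i j x} → MaxLevel i x → MaxLevel j x → i ≡ j
    MaxLevel-unique (perᵢ , ¬perᵢ₊₁) (perⱼ , ¬perⱼ₊₁) =
      ≤-antisym (below ¬perⱼ₊₁ perᵢ) (below ¬perᵢ₊₁ perⱼ)
      where
        below : ∀ {i j x} → ¬ PeriodicToLevel (suc j) (g x) → PeriodicToLevel i (g x) → i ≤ j
        below ¬per per = ≮⇒≥ (λ j<i → ¬per (PeriodicToLevel-antitone j<i per))

    MaxLevel-decimate : ∀ {j x} → MaxLevel (suc j) x → ∃ λ y → MaxLevel j y
    MaxLevel-decimate {j} {x} (per , ¬per)
      with ¬∀⟶∃¬ k _ (λ r → PeriodicToLevel? (suc j) _)
                 (λ decimations → ¬per (PeriodicToLevel-interleave {j} per decimations))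
    ... | r , ¬perʳ with decimation-closed x r
    ... | y , y≗ = y , PeriodicOn-≗ (sym ∘ y≗) (PeriodicToLevel-decimate {j} (toℕ<n r) per)
                     , ¬perʳ ∘ PeriodicOn-≗ y≗

    MaxLevel-descend : ∀ d {j x} → MaxLevel (d + j) x → ∃ λ y → MaxLevel j y
    MaxLevel-descend zero    max = _ , max
    MaxLevel-descend (suc d) {j} max = MaxLevel-descend d (proj₂ (MaxLevel-decimate {d + j} max))

    MaxLevel-descendTo : ∀ {j x} → MaxLevel (j + m) x →
                         (t : Fin (suc m)) → ∃ λ y → MaxLevel (toℕ t + j) y
    MaxLevel-descendTo {j} {x} max t =
      MaxLevel-descend (m ∸ toℕ t) (subst (λ i → MaxLevel i x) j+m≡[m-t]+[t+j] max)
      where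
        open ≡-Reasoning
        j+m≡[m-t]+[t+j] : j + m ≡ m ∸ toℕ t + (toℕ t + j)
        j+m≡[m-t]+[t+j] = begin
          j + m                     ≡⟨ +-comm j m ⟩
          m + j                     ≡⟨ cong (_+ j) (m∸n+n≡m (≤-pred (toℕ<n t))) ⟨
          m ∸ toℕ t + toℕ t + j     ≡⟨ +-assoc (m ∸ toℕ t) (toℕ t) j ⟩
          m ∸ toℕ t + (toℕ t + j)   ∎

    ¬MaxLevel-beyond : ∀ j x → ¬ MaxLevel (j + m) x
    ¬MaxLevel-beyond j x max with pigeonhole (n<1+n m) (proj₁ ∘ MaxLevel-descendTo {j} max)
    ... | t₁ , t₂ , t₁<t₂ , same = <-irrefl (+-cancelʳ-≡ j (toℕ t₁) (toℕ t₂) t₁+j≡t₂+j) t₁<t₂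
      where
        t₁+j≡t₂+j : toℕ t₁ + j ≡ toℕ t₂ + j
        t₁+j≡t₂+j = MaxLevel-unique (proj₂ (MaxLevel-descendTo {j} max t₁))
                      (subst (MaxLevel (toℕ t₂ + j)) (sym same) (proj₂ (MaxLevel-descendTo {j} max t₂)))

    PeriodicToLevel-beyond : ∀ j {x} → PeriodicToLevel m (g x) → PeriodicToLevel (j + m) (g x)
    PeriodicToLevel-beyond zero    per = per
    PeriodicToLevel-beyond (suc j) {x} per =
      decidable-stable (PeriodicToLevel? (suc (j + m)) (g x))
        (λ ¬per → ¬MaxLevel-beyond j x (PeriodicToLevel-beyond j per , ¬per))

    PeriodicToLevel⇒PeriodicOn : 1 < k → ∀ {x} → PeriodicToLevel m (g x) → ∀ B → PeriodicOn a p B (g x)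
    PeriodicToLevel⇒PeriodicOn 1<k per B =
      PeriodicOn-mono ≤-refl B≤level (PeriodicToLevel-beyond B per)
      where
        instance
          a+p≢0 : NonZero (a + p)
          a+p≢0 = >-nonZero (<-≤-trans 0<p (m≤n+m p a))
        open ≤-Reasoning
        B≤level : B ≤ k ^ (B + m) * (a + p)
        B≤level = begin
          B                        ≤⟨ <⇒≤ (n<k^n 1<k B) ⟩
          k ^ B                    ≤⟨ ^-monoʳ-≤ k (m≤m+n B m) ⟩
          k ^ (B + m)              ≤⟨ m≤m*n (k ^ (B + m)) (a + p) ⟩
          k ^ (B + m) * (a + p)    ∎

module _ {A : Set} (u : Seq A) (k : ℕ) {m : ℕ} (rep : Fin m → KernelIndex k)
         (covers : ∀ t → ∃ λ i → kernelSeq u k t ≗ kernelSeq u k (rep i)) where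

  decimatedIndex : KernelIndex k → Fin k → KernelIndex k
  decimatedIndex (e , j , j<kᵉ) r = suc e , j + k ^ e * toℕ r , bound
    where
      open ≤-Reasoning
      bound : j + k ^ e * toℕ r < k ^ suc e
      bound = begin-strict
        j + k ^ e * toℕ r     <⟨ +-monoˡ-< (k ^ e * toℕ r) j<kᵉ ⟩
        k ^ e + k ^ e * toℕ r ≡⟨ *-suc (k ^ e) (toℕ r) ⟨
        k ^ e * suc (toℕ r)   ≤⟨ *-monoʳ-≤ (k ^ e) (toℕ<n r) ⟩
        k ^ e * k             ≡⟨ *-comm (k ^ e) k ⟩
        k ^ suc e             ∎

  kernelSeq-decimatedIndex : ∀ t r →
    kernelSeq u k (decimatedIndex t r) ≗ (λ n → kernelSeq u k t (k * n + toℕ r))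
  kernelSeq-decimatedIndex (e , j , _) r n = cong u (reindex k (k ^ e) n j (toℕ r))
    where
      reindex : ∀ k kᵉ n j r → k * kᵉ * n + (j + kᵉ * r) ≡ kᵉ * (k * n + r) + j
      reindex = solve-∀

  kernel-decimation-closed : ∀ x (r : Fin k) →
    ∃ λ y → kernelSeq u k (rep y) ≗ (λ n → kernelSeq u k (rep x) (k * n + toℕ r))
  kernel-decimation-closed x r with covers (decimatedIndex (rep x) r)
  ... | y , ≗y = y , λ n → trans (sym (≗y n)) (kernelSeq-decimatedIndex (rep x) r n)

  kernel-contains-u : ∃ λ x → kernelSeq u k (rep x) ≗ u
  kernel-contains-u with covers (0 , 0 , z<s)
  ... | x , ≗x = x , λ n → trans (sym (≗x n)) (cong u (trans (+-identityʳ (1 * n)) (*-identityˡ n)))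

module _ {A : Set} where

  IsPrefix-≗ : ∀ {W} {u v : Seq A} → u ≗ v → IsPrefix W u → IsPrefix W v
  IsPrefix-≗ u≗v pre i = trans (pre i) (u≗v _)

  IsPrefix-agree : ∀ {W} {u v : Seq A} → IsPrefix W u → IsPrefix W v →
                   ∀ {n} → n < length W → u n ≡ v n
  IsPrefix-agree {u = u} {v} preᵘ preᵛ n<|W| =
    subst (λ n → u n ≡ v n) (toℕ-fromℕ< n<|W|)
      (trans (sym (preᵘ (fromℕ< n<|W|))) (preᵛ (fromℕ< n<|W|)))

  IsPrefix-++⁺ : ∀ U {W} {u : Seq A} → IsPrefix U u → IsPrefix W (λ n → u (length U + n)) →
                 IsPrefix (U ++ W) u
  IsPrefix-++⁺ []              preᵁ preᵂ = preᵂ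
  IsPrefix-++⁺ (x ∷ U)         preᵁ preᵂ zero    = preᵁ zero
  IsPrefix-++⁺ (x ∷ U) {u = u} preᵁ preᵂ (suc i) = IsPrefix-++⁺ U {u = u ∘ suc} (preᵁ ∘ suc) preᵂ i

  IsPrefix-++⁻ʳ : ∀ U {W} {u : Seq A} → IsPrefix (U ++ W) u → IsPrefix W (λ n → u (length U + n))
  IsPrefix-++⁻ʳ []              pre = pre
  IsPrefix-++⁻ʳ (x ∷ U) {u = u} pre = IsPrefix-++⁻ʳ U {u = u ∘ suc} (pre ∘ suc)

  IsPrefix-take : ∀ c W {u : Seq A} → IsPrefix W u → IsPrefix (take c W) u
  IsPrefix-take zero    W           pre ()
  IsPrefix-take (suc c) []          pre ()
  IsPrefix-take (suc c) (x ∷ W)     pre zero    = pre zero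
  IsPrefix-take (suc c) (x ∷ W) {u} pre (suc i) = IsPrefix-take c W {u ∘ suc} (pre ∘ suc) i

  cycle : (V : List A) .{{_ : NonZero (length V)}} → Seq A
  cycle V n = lookup V (n mod length V)

  module _ (V : List A) .{{_ : NonZero (length V)}} where

    cycle-periodic : ∀ n → cycle V (n + length V) ≡ cycle V n
    cycle-periodic n = cong (lookup V) (fromℕ<-cong _ _ ([m+n]%n≡m%n n (length V)) _ _)

    IsPrefix-cycle : IsPrefix V (cycle V)
    IsPrefix-cycle i = cong (lookup V) (sym (trans
      (fromℕ<-cong _ _ (m<n⇒m%n≡m (toℕ<n i)) _ (toℕ<n i)) (fromℕ<-toℕ i (toℕ<n i))))

    IsPrefix-power-cycle : ∀ f c → IsPrefix (concat (replicate f V) ++ take c V) (cycle V)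
    IsPrefix-power-cycle zero    c = IsPrefix-take c V {cycle V} IsPrefix-cycle
    IsPrefix-power-cycle (suc f) c =
      subst (λ W → IsPrefix W (cycle V)) (sym (++-assoc V (concat (replicate f V)) (take c V)))
        (IsPrefix-++⁺ V {u = cycle V} IsPrefix-cycle
          (IsPrefix-≗ {concat (replicate f V) ++ take c V} cycle-shifted (IsPrefix-power-cycle f c)))
      where
        cycle-shifted : cycle V ≗ (λ n → cycle V (length V + n))
        cycle-shifted n = sym (trans (cong (cycle V) (+-comm (length V) n)) (cycle-periodic n))

    IsPrefix-wpow-cycle : ∀ s → IsPrefix (wpow V s) (cycle V)
    IsPrefix-wpow-cycle s = IsPrefix-power-cycle ∣ floor s ∣ _

  IsPrefix⇒PeriodicOn : ∀ U V .{{_ : NonZero (length V)}} s {u : Seq A} →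
                        IsPrefix (U ++ wpow V s) u →
                        PeriodicOn (length U) (length V) (length (U ++ wpow V s)) u
  IsPrefix⇒PeriodicOn U V s {u} pre =
    subst (λ B → PeriodicOn (length U) (length V) B u) (sym (length-++ U))
      (PeriodicOn-shift {f = u} per)
    where
      w : Seq A
      w n = u (length U + n)
      agree : ∀ {n} → n < length (wpow V s) → w n ≡ cycle V n
      agree = IsPrefix-agree {wpow V s} {w} {cycle V} (IsPrefix-++⁻ʳ U {u = u} pre) (IsPrefix-wpow-cycle V s)
      per : PeriodicOn 0 (length V) (length (wpow V s)) w
      per {n} _ n+p<|X| = begin
        w n                    ≡⟨ agree (≤-<-trans (m≤m+n n (length V)) n+p<|X|) ⟩
        cycle V n              ≡⟨ cycle-periodic V n ⟨
        cycle V (n + length V) ≡⟨ agree n+p<|X| ⟨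
        w (n + length V)       ∎
        where open ≡-Reasoning

lemma1 : (k a : ℕ) → k ≥ 2 → (u : Seq (Fin a)) → ¬ EventuallyPeriodic u
    → (U V : List (Fin a)) → 0 < length V → (s : ℚ) → 0ℚ <ℚ s
    → IsPrefix (U ++ wpow V s) u
    → (m : ℕ) → KernelCard u k m
    → length (U ++ wpow V s) < k ^ m * length (U ++ V)
lemma1 k a k≥2 u nep U V 0<p s _ pre m (rep , _ , covers) =
  ≰⇒> λ long → nep (length V , length U , 0<p ,
                    λ n a≤n → sym (periodic long (suc (n + length V)) a≤n ≤-refl))
  where
    instance
      k≢0 : NonZero k
      k≢0 = >-nonZero (<-trans z<s k≥2)
      |V|≢0 : NonZero (length V)
      |V|≢0 = >-nonZero 0<p
    open Levels _≟ᶠ_ k (length U) (length V) 0<p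

    x₀ : Fin m
    x₀ = proj₁ (kernel-contains-u u k rep covers)

    x₀≗u : kernelSeq u k (rep x₀) ≗ u
    x₀≗u = proj₂ (kernel-contains-u u k rep covers)

    periodic : k ^ m * length (U ++ V) ≤ length (U ++ wpow V s) →
               ∀ B → PeriodicOn (length U) (length V) B u
    periodic long B = PeriodicOn-≗ x₀≗u
      (PeriodicToLevel⇒PeriodicOn (kernelSeq u k ∘ rep) (kernel-decimation-closed u k rep covers)
        k≥2 {x₀} level-m B)
      where
        window : k ^ m * (length U + length V) ≤ length (U ++ wpow V s)
        window = subst (λ L → k ^ m * L ≤ length (U ++ wpow V s)) (length-++ U) long
        level-m : PeriodicToLevel m (kernelSeq u k (rep x₀))
        level-m = PeriodicOn-≗ (sym ∘ x₀≗u) (PeriodicOn-mono ≤-refl window (IsPrefix⇒PeriodicOn U V s pre))
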